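{- Let $k=2^s$ for some $s\in\mathbb{N}$, and let $I\subset[k]$ be an interval (a set of consecutive integers) with $0<|I|\le k/2$. Then $$|\tilde\partial(I)|\le 6|I|\log_2(k/|I|).$$
   Context: $[k]=\{1,\dots,k\}$. Let $\phi:\{0,1\}^s\to[k]$, $\phi(x_1,\dots,x_s)=1+\sum_{i=1}^sx_i2^{i-1}$, and for $z\in[k]$ let $z_i=(\phi^{ -1}(z))_i$ for $i\in[s]$. For $B\subset[k]$, $\tilde\partial(B)$ denotes the edge-boundary in the discrete cube $\{0,1\}^s$ of $\phi^{ -1}(B)$; equivalently, $$|\tilde\partial(B)|=\#\{(z,i)\in[k]\times[s]:\ z_i=0,\ 1_B(z)\ne1_B(z+2^{i-1})\}.$$ -}

module Defs where

open import Data.Nat using (ℕ; zero; suc; _+_; _*_; _∸_; _^_; _≤ᵇ_; _≡ᵇ_; _/_; _%_)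
open import Data.Bool using (Bool; true; false; _∧_; _xor_; if_then_else_)
open import Data.List using (List; map; upTo)
open import Data.Nat.ListAction using (sum)

range1 : ℕ → List ℕ
range1 n = map suc (upTo n)

shiftR : ℕ → ℕ → ℕ
shiftR n zero = n
shiftR n (suc i) = shiftR (n / 2) i

-- z_i = (φ⁻¹(z))_i for z ∈ [k], i ∈ [s]  (i-th binary digit of z-1, i ≥ 1)
digit : ℕ → ℕ → ℕ
digit z i = shiftR (z ∸ 1) (i ∸ 1) % 2

-- |∂̃(B)| for k = 2^s and B ⊆ [k] given by its indicator 1_B :
-- #{(z,i) ∈ [k]×[s] : z_i = 0, 1_B(z) ≠ 1_B(z + 2^(i-1))}
boundarySize : (s : ℕ) → (ℕ → Bool) → ℕ
boundarySize s B =
  sum (map (λ z → sum (map (λ i →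
        if (digit z i ≡ᵇ 0) ∧ (B z xor B (z + 2 ^ (i ∸ 1))) then 1 else 0)
      (range1 s))) (range1 (2 ^ s)))

interval : ℕ → ℕ → ℕ → Bool
interval a b z = (a ≤ᵇ z) ∧ (z ≤ᵇ b)

-- Identify [k], k = 2^s, with {0,1}^s.  An edge in direction i joins z and
-- z + d with d = 2^(i-1); dropping the digit condition, the number D i of
-- boundary edges in direction i is at most the number of z ∈ [k] with
-- 1_I(z) ≠ 1_I(z + d).  Such a z lies in I or has z + d ∈ I, so D i ≤ 2|I|;
-- it also lies in one of the two windows of length d just before a or at
-- the end of I, so D i ≤ 2d = 2^i.  Writing L = |I|, the theorem
--   L^(6L) · 2^|∂̃I| ≤ 2^(6Ls)      (i.e. |∂̃I| ≤ 6L log₂(k/L))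
-- then follows by induction on s from these two bounds alone: while
-- 2L ≤ 2^(s-1) the last direction costs at most 2L ≤ 6L, and once
-- 2^(s-1) < 2L the geometric bound gives Σ_{i<s} 2^i + 2L ≤ 6L in total,
-- while L ≤ 2^(s-1) absorbs L^(6L).
module Submission where

open import Defs
open import Data.Nat using (ℕ; zero; suc; _+_; _*_; _∸_; _^_; _≤_; _<_; z≤n; s≤s; _≤ᵇ_; _≡ᵇ_; _≤?_)
open import Data.Nat.Properties
open import Data.Nat.ListAction using (sum)
open import Data.Nat.ListAction.Properties using (sum-++)
open import Data.Nat.Tactic.RingSolver using (solve-∀)
open import Data.Bool using (Bool; true; false; _∧_; _xor_; if_then_else_)
open import Data.List using (map; upTo; _++_; [_])
open import Data.List.Properties using (upTo-∷ʳ; map-++)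
open import Data.Product using (_×_; _,_; proj₂)
open import Data.Sum using (_⊎_; inj₁; inj₂)
open import Data.Empty using (⊥-elim)
open import Relation.Nullary using (yes; no)
open import Relation.Nullary.Reflects using (ofʸ; ofⁿ)
open import Relation.Binary.PropositionalEquality using (_≡_; refl; sym; trans; cong; cong₂; subst; module ≡-Reasoning)

indicator : Bool → ℕ
indicator b = if b then 1 else 0

indicator-xor : ∀ x y → indicator (x xor y) ≤ indicator x + indicator y
indicator-xor false false = z≤n
indicator-xor false true  = s≤s z≤n
indicator-xor true  false = s≤s z≤n
indicator-xor true  true  = z≤n

indicator-∧ : ∀ c x → indicator (c ∧ x) ≤ indicator x
indicator-∧ true  x = ≤-refl
indicator-∧ false x = z≤n

sumTo : ℕ → (ℕ → ℕ) → ℕ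
sumTo zero    f = 0
sumTo (suc n) f = sumTo n f + f (suc n)

sum-range1 : ∀ (f : ℕ → ℕ) n → sum (map f (range1 n)) ≡ sumTo n f
sum-range1 f zero = refl
sum-range1 f (suc n) = begin
    sum (map f (map suc (upTo (suc n))))
  ≡⟨ cong (λ l → sum (map f (map suc l))) (sym (upTo-∷ʳ n)) ⟩
    sum (map f (map suc (upTo n ++ [ n ])))
  ≡⟨ cong (λ l → sum (map f l)) (map-++ suc (upTo n) [ n ]) ⟩
    sum (map f (range1 n ++ [ suc n ]))
  ≡⟨ cong sum (map-++ f (range1 n) [ suc n ]) ⟩
    sum (map f (range1 n) ++ [ f (suc n) ])
  ≡⟨ sum-++ (map f (range1 n)) [ f (suc n) ] ⟩
    sum (map f (range1 n)) + (f (suc n) + 0)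
  ≡⟨ cong₂ _+_ (sum-range1 f n) (+-identityʳ _) ⟩
    sumTo n f + f (suc n)
  ∎
  where open ≡-Reasoning

sumTo-mono : ∀ n {f g : ℕ → ℕ} → (∀ i → f i ≤ g i) → sumTo n f ≤ sumTo n g
sumTo-mono zero    f≤g = z≤n
sumTo-mono (suc n) f≤g = +-mono-≤ (sumTo-mono n f≤g) (f≤g (suc n))

sumTo-zero : ∀ n → sumTo n (λ _ → 0) ≡ 0
sumTo-zero zero    = refl
sumTo-zero (suc n) = trans (+-identityʳ _) (sumTo-zero n)

sumTo-+ : ∀ n (f g : ℕ → ℕ) → sumTo n (λ i → f i + g i) ≡ sumTo n f + sumTo n g
sumTo-+ zero    f g = refl
sumTo-+ (suc n) f g = begin
    sumTo n (λ i → f i + g i) + (f (suc n) + g (suc n))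
  ≡⟨ cong (_+ (f (suc n) + g (suc n))) (sumTo-+ n f g) ⟩
    (sumTo n f + sumTo n g) + (f (suc n) + g (suc n))
  ≡⟨ interchange (sumTo n f) (sumTo n g) (f (suc n)) (g (suc n)) ⟩
    (sumTo n f + f (suc n)) + (sumTo n g + g (suc n))
  ∎
  where
  open ≡-Reasoning
  interchange : ∀ a b c d → (a + b) + (c + d) ≡ (a + c) + (b + d)
  interchange = solve-∀

sumTo-swap : ∀ n m (f : ℕ → ℕ → ℕ) →
             sumTo n (λ z → sumTo m (f z)) ≡ sumTo m (λ i → sumTo n (λ z → f z i))
sumTo-swap zero    m f = sym (sumTo-zero m)
sumTo-swap (suc n) m f =
  trans (cong (_+ sumTo m (f (suc n))) (sumTo-swap n m f))
        (sym (sumTo-+ m (λ i → sumTo n (λ z → f z i)) (f (suc n))))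

interval-cases : ∀ p q z → (interval p q z ≡ true  × p ≤ z × z ≤ q)
                         ⊎ (interval p q z ≡ false × (z < p ⊎ q < z))
interval-cases p q z with p ≤ᵇ z | ≤ᵇ-reflects-≤ p z
... | false | ofⁿ p≰z = inj₂ (refl , inj₁ (≰⇒> p≰z))
... | true  | ofʸ p≤z with z ≤ᵇ q | ≤ᵇ-reflects-≤ z q
...   | false | ofⁿ z≰q = inj₂ (refl , inj₂ (≰⇒> z≰q))
...   | true  | ofʸ z≤q = inj₁ (refl , p≤z , z≤q)

interval-∋ : ∀ p q z → p ≤ z → z ≤ q → interval p q z ≡ true
interval-∋ p q z p≤z z≤q with interval-cases p q z
... | inj₁ (z∈ , _)          = z∈
... | inj₂ (_ , inj₁ z<p)    = ⊥-elim (<⇒≱ z<p p≤z)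
... | inj₂ (_ , inj₂ q<z)    = ⊥-elim (<⇒≱ q<z z≤q)

-- Points of the shifted window {1+c, …, N+c} hit by {p, …, q}: at most
-- (N + c + 1) ∸ p (points below N + c) and at most the size q + 1 ∸ p.
-- The first bound is the invariant that makes the induction on N work.
window-count : ∀ p q c N →
  let hits = sumTo N (λ z → indicator (interval p q (z + c)))
  in hits ≤ suc (N + c) ∸ p × hits ≤ suc q ∸ p
window-count p q c zero = z≤n , z≤n
window-count p q c (suc N) with window-count p q c N | interval-cases p q (suc N + c)
... | (≤prefix , ≤size) | inj₂ (∉ , _) rewrite ∉ | +-identityʳ (sumTo N (λ z → indicator (interval p q (z + c)))) =
      ≤-trans ≤prefix (∸-monoˡ-≤ p (n≤1+n _)) , ≤size
... | (≤prefix , ≤size) | inj₁ (∈ , p≤ , ≤q) rewrite ∈ =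
      ≤prefix′ , ≤-trans ≤prefix′ (∸-monoˡ-≤ p (s≤s ≤q))
  where
  open ≤-Reasoning
  hits = sumTo N (λ z → indicator (interval p q (z + c)))
  ≤prefix′ : hits + 1 ≤ suc (suc (N + c)) ∸ p
  ≤prefix′ = begin
    hits + 1                 ≤⟨ +-monoˡ-≤ 1 ≤prefix ⟩
    (suc (N + c) ∸ p) + 1    ≡⟨ sym (+-∸-comm 1 p≤) ⟩
    suc (N + c) + 1 ∸ p      ≡⟨ cong (_∸ p) (+-comm (suc (N + c)) 1) ⟩
    suc (suc (N + c)) ∸ p    ∎

window-count-size : ∀ p q c N → sumTo N (λ z → indicator (interval p q (z + c))) ≤ suc q ∸ p
window-count-size p q c N = proj₂ (window-count p q c N)

shiftBoundary : ℕ → ℕ → ℕ → ℕ → ℕ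
shiftBoundary a b N d = sumTo N (λ z → indicator (interval a b z xor interval a b (z + d)))

-- Each such z has z ∈ I or z + d ∈ I, so the count is at most 2|I|.
shiftBoundary-≤-size : ∀ a b N d → shiftBoundary a b N d ≤ (suc b ∸ a) + (suc b ∸ a)
shiftBoundary-≤-size a b N d = begin
    shiftBoundary a b N d
  ≤⟨ sumTo-mono N pointwise ⟩
    sumTo N (λ z → indicator (interval a b (z + 0)) + indicator (interval a b (z + d)))
  ≡⟨ sumTo-+ N _ _ ⟩
    sumTo N (λ z → indicator (interval a b (z + 0))) + sumTo N (λ z → indicator (interval a b (z + d)))
  ≤⟨ +-mono-≤ (window-count-size a b 0 N) (window-count-size a b d N) ⟩
    (suc b ∸ a) + (suc b ∸ a) ∎
  where
  open ≤-Reasoning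
  pointwise : ∀ z → indicator (interval a b z xor interval a b (z + d))
                    ≤ indicator (interval a b (z + 0)) + indicator (interval a b (z + d))
  pointwise z rewrite +-identityʳ z = indicator-xor (interval a b z) (interval a b (z + d))

shift-escapes : ∀ a b d z →
  indicator (interval a b z xor interval a b (z + suc d))
  ≤ indicator (interval (suc b) (b + suc d) (z + suc d)) + indicator (interval a (a + d) (z + suc d))
shift-escapes a b d z with interval-cases a b z | interval-cases a b (z + suc d)
... | inj₁ (∈₁ , _) | inj₁ (∈₂ , _) rewrite ∈₁ | ∈₂ = z≤n
... | inj₂ (∉₁ , _) | inj₂ (∉₂ , _) rewrite ∉₁ | ∉₂ = z≤n
... | inj₁ (∈₁ , a≤z , _) | inj₂ (∉₂ , inj₁ z+d<a) rewrite ∈₁ | ∉₂ =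
      ⊥-elim (<⇒≱ z+d<a (≤-trans a≤z (m≤m+n z (suc d))))
... | inj₁ (∈₁ , _ , z≤b) | inj₂ (∉₂ , inj₂ b<z+d) rewrite ∈₁ | ∉₂
      | interval-∋ (suc b) (b + suc d) (z + suc d) b<z+d (+-monoˡ-≤ (suc d) z≤b) = s≤s z≤n
... | inj₂ (∉₁ , inj₂ b<z) | inj₁ (∈₂ , _ , z+d≤b) rewrite ∉₁ | ∈₂ =
      ⊥-elim (<⇒≱ b<z (≤-trans (m≤m+n z (suc d)) z+d≤b))
... | inj₂ (∉₁ , inj₁ z<a) | inj₁ (∈₂ , a≤z+d , _) rewrite ∉₁ | ∈₂
      | interval-∋ a (a + d) (z + suc d) a≤z+d
          (≤-pred (subst (suc (z + suc d) ≤_) (+-suc a d) (+-monoˡ-≤ (suc d) z<a)))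
      = m≤n+m 1 _

shiftBoundary-≤-shift : ∀ a b N d → 1 ≤ d → shiftBoundary a b N d ≤ d + d
shiftBoundary-≤-shift a b N (suc d) _ = begin
    shiftBoundary a b N (suc d)
  ≤⟨ sumTo-mono N (shift-escapes a b d) ⟩
    sumTo N (λ z → indicator (interval (suc b) (b + suc d) (z + suc d))
                 + indicator (interval a (a + d) (z + suc d)))
  ≡⟨ sumTo-+ N _ _ ⟩
    sumTo N (λ z → indicator (interval (suc b) (b + suc d) (z + suc d)))
      + sumTo N (λ z → indicator (interval a (a + d) (z + suc d)))
  ≤⟨ +-mono-≤ (window-count-size (suc b) (b + suc d) (suc d) N)
              (window-count-size a (a + d) (suc d) N) ⟩
    (suc (b + suc d) ∸ suc b) + (suc (a + d) ∸ a)
  ≡⟨ cong₂ _+_ (m+n∸m≡n b (suc d))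
               (trans (cong (_∸ a) (sym (+-suc a d))) (m+n∸m≡n a (suc d))) ⟩
    suc d + suc d ∎
  where open ≤-Reasoning

-- The boundary of Defs is bounded by the sum of the shift boundaries over
-- all directions, d = 2^(i-1) (forgetting the digit condition z_i = 0).
boundary-≤-shiftBoundaries : ∀ s a b →
  boundarySize s (interval a b) ≤ sumTo s (λ i → shiftBoundary a b (2 ^ s) (2 ^ (i ∸ 1)))
boundary-≤-shiftBoundaries s a b = begin
    boundarySize s (interval a b)
  ≡⟨ sum-range1 _ (2 ^ s) ⟩
    sumTo (2 ^ s) (λ z → sum (map (edge z) (range1 s)))
  ≤⟨ sumTo-mono (2 ^ s) (λ z → ≤-trans (≤-reflexive (sum-range1 (edge z) s))
                                       (sumTo-mono s (λ i → indicator-∧ (digit z i ≡ᵇ 0) _))) ⟩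
    sumTo (2 ^ s) (λ z → sumTo s (differs z))
  ≡⟨ sumTo-swap (2 ^ s) s differs ⟩
    sumTo s (λ i → shiftBoundary a b (2 ^ s) (2 ^ (i ∸ 1))) ∎
  where
  open ≤-Reasoning
  differs : ℕ → ℕ → ℕ
  differs z i = indicator (interval a b z xor interval a b (z + 2 ^ (i ∸ 1)))
  edge : ℕ → ℕ → ℕ
  edge z i = indicator ((digit z i ≡ᵇ 0) ∧ (interval a b z xor interval a b (z + 2 ^ (i ∸ 1))))

geometric : ∀ n → sumTo n (λ i → 2 ^ (i ∸ 1) + 2 ^ (i ∸ 1)) + 2 ≡ 2 * 2 ^ n
geometric zero    = refl
geometric (suc n) = begin
    (sumTo n double + (2 ^ n + 2 ^ n)) + 2
  ≡⟨ rotate (sumTo n double) (2 ^ n + 2 ^ n) ⟩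
    (sumTo n double + 2) + (2 ^ n + 2 ^ n)
  ≡⟨ cong (_+ (2 ^ n + 2 ^ n)) (geometric n) ⟩
    2 * 2 ^ n + (2 ^ n + 2 ^ n)
  ≡⟨ doubling (2 ^ n) ⟩
    2 * (2 * 2 ^ n) ∎
  where
  open ≡-Reasoning
  double : ℕ → ℕ
  double i = 2 ^ (i ∸ 1) + 2 ^ (i ∸ 1)
  rotate : ∀ x y → (x + y) + 2 ≡ (x + 2) + y
  rotate = solve-∀
  doubling : ∀ x → 2 * x + (x + x) ≡ 2 * (2 * x)
  doubling = solve-∀

pow-step : ∀ m s → 2 ^ (m * suc s) ≡ 2 ^ (m * s) * 2 ^ m
pow-step m s = begin
  2 ^ (m * suc s)      ≡⟨ cong (2 ^_) (trans (*-suc m s) (+-comm m (m * s))) ⟩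
  2 ^ (m * s + m)      ≡⟨ ^-distribˡ-+-* 2 (m * s) m ⟩
  2 ^ (m * s) * 2 ^ m  ∎
  where open ≡-Reasoning

six-split : ∀ L → 2 * (2 * L) + (L + L) ≡ 6 * L
six-split = solve-∀

twice-≤-six : ∀ L → L + L ≤ 6 * L
twice-≤-six L = subst (L + L ≤_) (six-split L) (m≤n+m (L + L) (2 * (2 * L)))

double-≤1 : ∀ L → 2 * L ≤ 1 → L ≡ 0
double-≤1 zero    _          = refl
double-≤1 (suc L) (s≤s 2L+1≤0) with m+n≤o⇒n≤o L 2L+1≤0
... | ()

-- Fix a size L and per-direction costs D i ≤ min(2^i, 2L); the bound below
-- needs nothing else about D.
module _ (L : ℕ) (D : ℕ → ℕ)
         (D≤shift : ∀ i → D i ≤ 2 ^ (i ∸ 1) + 2 ^ (i ∸ 1))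
         (D≤size  : ∀ i → D i ≤ L + L) where

  -- Adding a direction costs at most 6L bits, matching one more factor 2^(6L).
  entropy-step : ∀ s → L ^ (6 * L) * 2 ^ sumTo s D ≤ 2 ^ (6 * L * s) →
                 L ^ (6 * L) * 2 ^ sumTo (suc s) D ≤ 2 ^ (6 * L * suc s)
  entropy-step s ih = begin
      L ^ (6 * L) * 2 ^ (sumTo s D + D (suc s))
    ≡⟨ cong (L ^ (6 * L) *_) (^-distribˡ-+-* 2 (sumTo s D) (D (suc s))) ⟩
      L ^ (6 * L) * (2 ^ sumTo s D * 2 ^ D (suc s))
    ≡⟨ sym (*-assoc (L ^ (6 * L)) _ _) ⟩
      (L ^ (6 * L) * 2 ^ sumTo s D) * 2 ^ D (suc s)
    ≤⟨ *-mono-≤ ih (^-monoʳ-≤ 2 (≤-trans (D≤size (suc s)) (twice-≤-six L))) ⟩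
      2 ^ (6 * L * s) * 2 ^ (6 * L)
    ≡⟨ sym (pow-step (6 * L) s) ⟩
      2 ^ (6 * L * suc s) ∎
    where open ≤-Reasoning

  -- When L ≤ 2^s ≤ 2L all s + 1 directions together cost at most
  -- (2^(s+1) − 2) + 2L ≤ 6L bits, and L^(6L) ≤ 2^(6Ls).
  entropy-saturated : ∀ s → L ≤ 2 ^ s → 2 ^ s ≤ 2 * L →
                      L ^ (6 * L) * 2 ^ sumTo (suc s) D ≤ 2 ^ (6 * L * suc s)
  entropy-saturated s L≤ ≤2L = begin
      L ^ (6 * L) * 2 ^ (sumTo s D + D (suc s))
    ≤⟨ *-mono-≤ (^-monoˡ-≤ (6 * L) L≤) (^-monoʳ-≤ 2 total) ⟩
      (2 ^ s) ^ (6 * L) * 2 ^ (6 * L)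
    ≡⟨ cong (_* 2 ^ (6 * L)) (trans (^-*-assoc 2 s (6 * L)) (cong (2 ^_) (*-comm s (6 * L)))) ⟩
      2 ^ (6 * L * s) * 2 ^ (6 * L)
    ≡⟨ sym (pow-step (6 * L) s) ⟩
      2 ^ (6 * L * suc s) ∎
    where
    open ≤-Reasoning
    earlier : sumTo s D ≤ 2 * (2 * L)
    earlier = ≤-trans (m≤m+n (sumTo s D) 2)
                (≤-trans (+-monoˡ-≤ 2 (sumTo-mono s D≤shift))
                  (subst (_≤ 2 * (2 * L)) (sym (geometric s)) (*-monoʳ-≤ 2 ≤2L)))
    total : sumTo s D + D (suc s) ≤ 6 * L
    total = subst (sumTo s D + D (suc s) ≤_) (six-split L) (+-mono-≤ earlier (D≤size (suc s)))

  entropy-bound : ∀ s → 2 * L ≤ 2 ^ s → L ^ (6 * L) * 2 ^ sumTo s D ≤ 2 ^ (6 * L * s)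
  entropy-bound zero    2L≤1 rewrite double-≤1 L 2L≤1 = ≤-refl
  entropy-bound (suc s) 2L≤ with 2 * L ≤? 2 ^ s
  ... | yes 2L≤′ = entropy-step s (entropy-bound s 2L≤′)
  ... | no  2L≰  = entropy-saturated s (*-cancelˡ-≤ 2 2L≤) (<⇒≤ (≰⇒> 2L≰))

lemma1 : (s a b : ℕ) → 1 ≤ a → a ≤ b → b ≤ 2 ^ s →
         2 * (b + 1 ∸ a) ≤ 2 ^ s →
         (b + 1 ∸ a) ^ (6 * (b + 1 ∸ a)) * 2 ^ boundarySize s (interval a b)
           ≤ 2 ^ (6 * (b + 1 ∸ a) * s)
lemma1 s a b _ _ _ 2L≤k rewrite +-comm b 1 =
  ≤-trans (*-monoʳ-≤ (L ^ (6 * L)) (^-monoʳ-≤ 2 (boundary-≤-shiftBoundaries s a b)))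
          (entropy-bound L D D≤shift D≤size s 2L≤k)
  where
  L = suc b ∸ a
  D : ℕ → ℕ
  D i = shiftBoundary a b (2 ^ s) (2 ^ (i ∸ 1))
  D≤shift : ∀ i → D i ≤ 2 ^ (i ∸ 1) + 2 ^ (i ∸ 1)
  D≤shift i = shiftBoundary-≤-shift a b (2 ^ s) (2 ^ (i ∸ 1)) (m^n>0 2 (i ∸ 1))
  D≤size : ∀ i → D i ≤ L + L
  D≤size i = shiftBoundary-≤-size a b (2 ^ s) (2 ^ (i ∸ 1))
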